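{- Let $\lambda\supseteq\mu$ be partitions, and let $z_k$ ($k\in\mathbb{Z}$) and $\mathbf{z}_T$ be as in the context. (a) If $\lambda=\mu$, then $\sum_{T\in\operatorname{SYT}(\lambda/\mu)}\mathbf{z}_T=1$. (b) If $\lambda\ne\mu$, then $$\sum_{T\in\operatorname{SYT}(\lambda/\mu)}\mathbf{z}_T=\frac{1}{\sum_{(i,j)\in Y(\lambda/\mu)}z_{j-i}}\cdot\sum_{\mu\lessdot\nu\subseteq\lambda}\ \sum_{T\in\operatorname{SYT}(\lambda/\nu)}\mathbf{z}_T,$$ where the outer sum on the right ranges over all partitions $\nu$ with $\mu\lessdot\nu\subseteq\lambda$.
   Context: Partitions are weakly decreasing eventually-zero sequences of nonnegative integers; $\mu\subseteq\lambda$ means $\mu_i\le\lambda_i$ for all $i$. $Y(\lambda/\mu)=\{(i,j)\in\mathbb{Z}_{>0}^2:\mu_i<j\le\lambda_i\}$. $\mu\lessdot\nu$ means $\mu\subseteq\nu$ and $|Y(\nu/\mu)|=1$. A standard tableau of shape $\lambda/\mu$ (with $n=|Y(\lambda/\mu)|$) is a bijection $T:Y(\lambda/\mu)\to\{1,\ldots,n\}$ increasing along rows (left to right) and columns (top to bottom); $\operatorname{SYT}(\lambda/\mu)$ is their set. With commuting indeterminates $z_k$ ($k\in\mathbb{Z}$), working in the field of rational functions over $\mathbb{Q}$, put $c_T(k)=j-i$ for the box $(i,j)$ containing $k$, and $\mathbf{z}_T=1/\prod_{k=1}^n(z_{c_T(k)}+z_{c_T(k+1)}+\cdots+z_{c_T(n)})$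 (an empty product being $1$). -}

module Defs where

open import Level using (Level)
open import Data.Nat using (ℕ; zero; suc; _≤_; _<_)
open import Data.Integer as ℤ using (ℤ; +_)
open import Data.Product using (_×_; _,_; ∃)
open import Data.List using (List; []; _∷_; length; lookup; foldr)
open import Data.List.Relation.Unary.All using (All)
open import Data.List.Relation.Unary.Linked using (Linked)
open import Data.List.Relation.Unary.Unique.Propositional using (Unique)
open import Data.List.Membership.Propositional using (_∈_)
open import Data.Fin as Fin using (Fin)
open import Function.Bundles using (_⇔_)
open import Relation.Binary.PropositionalEquality using (_≡_)
open import Algebra.Bundles using (CommutativeRing)

-- A partition is represented by the list of its nonzero parts
-- (weakly decreasing, all positive); parts beyond the list are 0.
IsPartition : List ℕ → Set
IsPartition p = Linked (λ a b → b ≤ a) p × All (λ a → 0 < a) p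

-- part p i = p_i  (1-indexed; p_0 := 0 is never used)
part : List ℕ → ℕ → ℕ
part []       _             = 0
part (x ∷ xs) zero          = 0
part (x ∷ xs) (suc zero)    = x
part (x ∷ xs) (suc (suc i)) = part xs (suc i)

_⊆ₚ_ : List ℕ → List ℕ → Set
mu ⊆ₚ la = ∀ i → part mu i ≤ part la i

Box : Set
Box = ℕ × ℕ

InY : List ℕ → List ℕ → Box → Set
InY la mu (i , j) = (1 ≤ i) × (part mu i < j) × (j ≤ part la i)

_⋖_ : List ℕ → List ℕ → Set
mu ⋖ nu = mu ⊆ₚ nu × ∃ λ b → InY nu mu b × (∀ b′ → InY nu mu b′ → b′ ≡ b)

-- A standard tableau T : Y(λ/μ) → {1..n} is encoded by its inverse,
-- the list of boxes  T⁻¹(1), …, T⁻¹(n)  (position p (0-based) holds label p+1).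
IsSYT : List ℕ → List ℕ → List Box → Set
IsSYT la mu T =
  Unique T
  × (∀ b → (b ∈ T) ⇔ InY la mu b)
  × (∀ (p q : Fin (length T)) (i j j′ : ℕ) →
       lookup T p ≡ (i , j) → lookup T q ≡ (i , j′) → j < j′ → p Fin.< q)
  × (∀ (p q : Fin (length T)) (i i′ j : ℕ) →
       lookup T p ≡ (i , j) → lookup T q ≡ (i′ , j) → i < i′ → p Fin.< q)

EnumeratesSYT : List ℕ → List ℕ → List (List Box) → Set
EnumeratesSYT la mu Ts = Unique Ts × (∀ T → (T ∈ Ts) ⇔ IsSYT la mu T)

content : Box → ℤ
content (i , j) = (+ j) ℤ.- (+ i)

module _ {c ℓ : Level} (R : CommutativeRing c ℓ) where
  open CommutativeRing R

  sumL : {A : Set} → List A → (A → Carrier) → Carrier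
  sumL xs f = foldr (λ x s → f x + s) 0# xs

  zsum : (ℤ → Carrier) → List Box → Carrier
  zsum z bs = sumL bs (λ b → z (content b))

  -- z_T = 1 / ∏_{k=1}^{n} (z_{c_T(k)} + … + z_{c_T(n)})
  zT : (Carrier → Carrier) → (ℤ → Carrier) → List Box → Carrier
  zT inv z []       = 1#
  zT inv z (b ∷ bs) = inv (zsum z (b ∷ bs)) * zT inv z bs

{-# OPTIONS --safe #-}
-- Removing the box labelled 1 from a standard tableau of shape λ/μ leaves a standard
-- tableau of shape λ/ν, where ν is μ with that box added, so μ ⋖ ν ⊆ λ; conversely
-- every such ν and tableau of shape λ/ν arise exactly once. The first factor of z_T is
-- 1 / Σ_{b ∈ Y(λ/μ)} z_{c(b)} for every T, which gives the recursion.
module Submission where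

open import Defs
open import Level using (Level)
open import Function using (_∘_; id)
open import Data.Unit using (⊤; tt)
open import Data.Empty using (⊥-elim)
open import Data.Nat using (ℕ; zero; suc; pred; _≤_; _<_; z≤n; s≤s; _≟_; _≤?_)
open import Data.Nat.Properties
  using (≤-refl; ≤-trans; ≤-reflexive; ≤-antisym; ≤-pred; <⇒≤; n≤1+n; <-irrefl; <-asym;
         ≤-<-trans; <-≤-trans; ≰⇒>; n≮0; m≤n⇒m<n∨m≡n)
open import Data.Integer using (ℤ)
open import Data.Fin as Fin using (Fin)
open import Data.Product using (_×_; _,_; proj₁; proj₂; ∃; map₁)
open import Data.Sum using (_⊎_; inj₁; inj₂; [_,_]′)
open import Data.List using (List; []; _∷_; _++_; map; concatMap; foldr; lookup; length; drop)
import Data.List.Properties as List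
open import Data.List.Relation.Unary.All as All using (All; []; _∷_)
open import Data.List.Relation.Unary.AllPairs using ([]; _∷_)
open import Data.List.Relation.Unary.Any using (here; there; index)
open import Data.List.Relation.Unary.Any.Properties using (lookup-index)
open import Data.List.Relation.Unary.Linked as Linked using ([-]; _∷_)
open import Data.List.Relation.Unary.Unique.Propositional using (Unique)
import Data.List.Relation.Unary.Unique.Propositional.Properties as Unique
open import Data.List.Membership.Propositional using (_∈_; find; lose)
open import Data.List.Membership.Propositional.Properties
  using (∈-lookup; ∈-map⁺; ∈-map⁻; ∈-concatMap⁺; ∈-concatMap⁻)
open import Data.List.Membership.Propositional.Properties.WithK using (unique∧set⇒bag)
open import Data.List.Relation.Binary.BagAndSetEquality using (∼bag⇒↭)
open import Data.List.Relation.Binary.Permutation.Propositional as ↭ using (_↭_)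
open import Function.Bundles using (_⇔_; mk⇔; Equivalence)
import Function.Properties.Equivalence as ⇔
open Equivalence using (to; from)
open import Relation.Nullary using (¬_; yes; no)
open import Relation.Binary.PropositionalEquality
  using (_≡_; _≢_; refl; sym; trans; cong; cong₂; subst; subst₂)
open import Algebra.Bundles using (CommutativeRing)

concatMap-unique : ∀ {A B : Set} (h : A → List B) {xs : List A} → Unique xs →
  (∀ {x} → x ∈ xs → Unique (h x)) →
  (∀ {x x′ y} → x ∈ xs → x′ ∈ xs → y ∈ h x → y ∈ h x′ → x ≡ x′) →
  Unique (concatMap h xs)
concatMap-unique h {[]} [] _ _ = []
concatMap-unique h {x ∷ xs} (x∉xs ∷ xs!) h! h-disjoint =
  Unique.++⁺ (h! (here refl))
    (concatMap-unique h xs! (h! ∘ there) (λ x∈ x′∈ → h-disjoint (there x∈) (there x′∈)))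
    λ (y∈hx , y∈rest) →
      let x′ , x′∈xs , y∈hx′ = find (∈-concatMap⁻ h y∈rest)
      in All.lookup x∉xs x′∈xs (h-disjoint (here refl) (there x′∈xs) y∈hx y∈hx′)

module Sums {c ℓ : Level} (R : CommutativeRing c ℓ) where
  open CommutativeRing R renaming (refl to ≈-refl; sym to ≈-sym; trans to ≈-trans)
  open import Relation.Binary.Reasoning.Setoid setoid
  import Algebra.Properties.CommutativeSemigroup +-commutativeSemigroup as +

  sumL-↭ : ∀ {A : Set} (f : A → Carrier) {xs ys} → xs ↭ ys → sumL R xs f ≈ sumL R ys f
  sumL-↭ f ↭.refl = ≈-refl
  sumL-↭ f (↭.prep x p) = +-congˡ (sumL-↭ f p)
  sumL-↭ f (↭.swap {xs} {ys} x y p) = begin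
    f x + (f y + sumL R xs f) ≈⟨ +-congˡ (+-congˡ (sumL-↭ f p)) ⟩
    f x + (f y + sumL R ys f) ≈⟨ +.x∙yz≈y∙xz (f x) (f y) _ ⟩
    f y + (f x + sumL R ys f) ∎
  sumL-↭ f (↭.trans p q) = ≈-trans (sumL-↭ f p) (sumL-↭ f q)

  sumL-⇔ : ∀ {A : Set} (f : A → Carrier) {xs ys} → Unique xs → Unique ys →
    (∀ x → x ∈ xs ⇔ x ∈ ys) → sumL R xs f ≈ sumL R ys f
  sumL-⇔ f xs! ys! xs⇔ys = sumL-↭ f (∼bag⇒↭ (unique∧set⇒bag xs! ys! (λ {x} → xs⇔ys x)))

  sumL-++ : ∀ {A : Set} (f : A → Carrier) xs ys → sumL R (xs ++ ys) f ≈ sumL R xs f + sumL R ys f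
  sumL-++ f [] ys = ≈-sym (+-identityˡ _)
  sumL-++ f (x ∷ xs) ys = ≈-trans (+-congˡ (sumL-++ f xs ys)) (≈-sym (+-assoc _ _ _))

  sumL-concatMap : ∀ {A B : Set} (f : B → Carrier) (h : A → List B) xs →
    sumL R (concatMap h xs) f ≈ sumL R xs (λ x → sumL R (h x) f)
  sumL-concatMap f h [] = ≈-refl
  sumL-concatMap f h (x ∷ xs) = ≈-trans (sumL-++ f (h x) (concatMap h xs)) (+-congˡ (sumL-concatMap f h xs))

  sumL-cong : ∀ {A : Set} {f g : A → Carrier} xs → (∀ {x} → x ∈ xs → f x ≈ g x) →
    sumL R xs f ≈ sumL R xs g
  sumL-cong [] _ = ≈-refl
  sumL-cong (x ∷ xs) f≈g = +-cong (f≈g (here refl)) (sumL-cong xs (f≈g ∘ there))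

  *-distribˡ-sumL : ∀ {A : Set} a (f : A → Carrier) xs →
    a * sumL R xs f ≈ sumL R xs (λ x → a * f x)
  *-distribˡ-sumL a f [] = zeroʳ a
  *-distribˡ-sumL a f (x ∷ xs) = ≈-trans (distribˡ a _ _) (+-congˡ (*-distribˡ-sumL a f xs))

  inv-cong : (inv : Carrier → Carrier) → (∀ x → ¬ (x ≈ 0#) → x * inv x ≈ 1#) →
    ∀ {x y} → ¬ (x ≈ 0#) → x ≈ y → inv x ≈ inv y
  inv-cong inv inverse {x} {y} x≉0 x≈y = begin
    inv x                 ≈⟨ ≈-sym (*-identityʳ _) ⟩
    inv x * 1#            ≈⟨ *-congˡ (≈-sym (inverse y (x≉0 ∘ ≈-trans x≈y))) ⟩
    inv x * (y * inv y)   ≈⟨ ≈-sym (*-assoc _ _ _) ⟩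
    (inv x * y) * inv y   ≈⟨ *-congʳ (*-congˡ (≈-sym x≈y)) ⟩
    (inv x * x) * inv y   ≈⟨ *-congʳ (≈-trans (*-comm _ _) (inverse x x≉0)) ⟩
    1# * inv y            ≈⟨ *-identityˡ _ ⟩
    inv y                 ∎

-- Partitions

part-zero : ∀ p → part p 0 ≡ 0
part-zero []      = refl
part-zero (_ ∷ _) = refl

part-drop : ∀ p k → part (drop 1 p) (suc k) ≡ part p (suc (suc k))
part-drop []      _ = refl
part-drop (_ ∷ _) _ = refl

IsPartition-tail : ∀ {x xs} → IsPartition (x ∷ xs) → IsPartition xs
IsPartition-tail (decreasing , positive) = Linked.tail decreasing , All.tail positive

IsPartition-∷ : ∀ {x xs} → 0 < x → part xs 1 ≤ x → IsPartition xs → IsPartition (x ∷ xs)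
IsPartition-∷ {xs = []}    x>0 _   _                       = [-] , x>0 ∷ []
IsPartition-∷ {xs = _ ∷ _} x>0 y≤x (decreasing , positive) = y≤x ∷ decreasing , x>0 ∷ positive

second≤head : ∀ {x xs} → IsPartition (x ∷ xs) → part xs 1 ≤ x
second≤head {xs = []}    _                = z≤n
second≤head {xs = _ ∷ _} (y≤x ∷ _ , _) = y≤x

part-antitone : ∀ {p} → IsPartition p → ∀ {a b} → 1 ≤ a → a ≤ b → part p b ≤ part p a
part-antitone {[]} _ {suc _} {suc _} _ _ = z≤n
part-antitone {_ ∷ _} _ {suc zero} {suc zero} _ _ = ≤-refl
part-antitone {_ ∷ _} P {suc zero} {suc (suc b)} _ _ =
  ≤-trans (part-antitone (IsPartition-tail P) {1} {suc b} ≤-refl (s≤s z≤n)) (second≤head P)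
part-antitone {_ ∷ _} P {suc (suc a)} {suc (suc b)} _ (s≤s a≤b) =
  part-antitone (IsPartition-tail P) {suc a} {suc b} (s≤s z≤n) a≤b

partition-ext : ∀ {p q} → IsPartition p → IsPartition q →
  (∀ k → part p (suc k) ≡ part q (suc k)) → p ≡ q
partition-ext {[]}    {[]}    _ _ _ = refl
partition-ext {[]}    {_ ∷ _} _ (_ , y>0 ∷ _) p≡q = ⊥-elim (<-irrefl (p≡q 0) y>0)
partition-ext {_ ∷ _} {[]}    (_ , x>0 ∷ _) _ p≡q = ⊥-elim (<-irrefl (sym (p≡q 0)) x>0)
partition-ext {_ ∷ _} {_ ∷ _} P Q p≡q =
  cong₂ _∷_ (p≡q 0) (partition-ext (IsPartition-tail P) (IsPartition-tail Q) (p≡q ∘ suc))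

record AddsBox (mu nu : List ℕ) (b : Box) : Set where
  field
    row-positive : 1 ≤ proj₁ b
    col≡         : proj₂ b ≡ suc (part mu (proj₁ b))
    part-row     : part nu (proj₁ b) ≡ proj₂ b
    part-other   : ∀ k → k ≢ proj₁ b → part nu k ≡ part mu k

module _ {mu nu : List ℕ} {i j : ℕ} (A : AddsBox mu nu (i , j)) where
  open AddsBox A

  AddsBox⇒⊆ₚ : mu ⊆ₚ nu
  AddsBox⇒⊆ₚ k with k ≟ i
  ... | yes refl = ≤-trans (n≤1+n _) (≤-reflexive (sym (trans part-row col≡)))
  ... | no k≢i   = ≤-reflexive (sym (part-other k k≢i))

  AddsBox-new : ∀ {b} → InY nu mu b → b ≡ (i , j)
  AddsBox-new {k , l} (_ , mu<l , l≤nu) with k ≟ i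
  ... | no k≢i   = ⊥-elim (<-irrefl refl (<-≤-trans mu<l (subst (l ≤_) (part-other k k≢i) l≤nu)))
  ... | yes refl = cong (k ,_) (≤-antisym (subst (l ≤_) part-row l≤nu) (subst (_≤ l) (sym col≡) mu<l))

  AddsBox-∉ : ∀ {la} → ¬ InY la nu (i , j)
  AddsBox-∉ (_ , nu<j , _) = <-irrefl part-row nu<j

  AddsBox⇒⋖ : mu ⋖ nu
  AddsBox⇒⋖ = AddsBox⇒⊆ₚ , (i , j) , (row-positive , ≤-reflexive (sym col≡) , ≤-reflexive (sym part-row)) ,
              λ _ → AddsBox-new

  AddsBox-within : ∀ {la} → mu ⊆ₚ la → j ≤ part la i → nu ⊆ₚ la
  AddsBox-within {la} mu⊆la j≤la k with k ≟ i
  ... | yes refl = subst (_≤ part la k) (sym part-row) j≤la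
  ... | no k≢i   = subst (_≤ part la k) (sym (part-other k k≢i)) (mu⊆la k)

  InY-AddsBox : ∀ {la} → j ≤ part la i → ∀ b → InY la mu b ⇔ (b ≡ (i , j) ⊎ InY la nu b)
  InY-AddsBox {la} j≤la (k , l) = mk⇔ split join
    where
    split : InY la mu (k , l) → (k , l) ≡ (i , j) ⊎ InY la nu (k , l)
    split (k≥1 , mu<l , l≤la) with l ≤? part nu k
    ... | yes l≤nu = inj₁ (AddsBox-new (k≥1 , mu<l , l≤nu))
    ... | no l≰nu  = inj₂ (k≥1 , ≰⇒> l≰nu , l≤la)
    join : (k , l) ≡ (i , j) ⊎ InY la nu (k , l) → InY la mu (k , l)
    join (inj₁ refl)                = row-positive , ≤-reflexive (sym col≡) , j≤la
    join (inj₂ (k≥1 , nu<l , l≤la)) = k≥1 , ≤-<-trans (AddsBox⇒⊆ₚ k) nu<l , l≤la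

AddsBox-functional : ∀ {mu nu nu′ b} → AddsBox mu nu b → AddsBox mu nu′ b → ∀ k → part nu k ≡ part nu′ k
AddsBox-functional {b = i , _} A A′ k with k ≟ i
... | yes refl = trans (AddsBox.part-row A) (sym (AddsBox.part-row A′))
... | no k≢i   = trans (AddsBox.part-other A k k≢i) (sym (AddsBox.part-other A′ k k≢i))

-- The box of ν/μ when μ ⋖ ν: the end of the first row in which ν and μ differ.
addedBox : List ℕ → List ℕ → Box
addedBox mu []       = (0 , 0)
addedBox mu (x ∷ xs) with x ≟ part mu 1
... | yes _ = map₁ suc (addedBox (drop 1 mu) xs)
... | no _  = (1 , x)

addedBox-first-difference : ∀ mu nu i → (∀ k → k ≢ suc i → part nu k ≡ part mu k) →
  part nu (suc i) ≢ part mu (suc i) → 0 < part nu (suc i) → addedBox mu nu ≡ (suc i , part nu (suc i))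
addedBox-first-difference mu (x ∷ xs) zero same differs _ with x ≟ part mu 1
... | yes x≡mu = ⊥-elim (differs x≡mu)
... | no _     = refl
addedBox-first-difference mu (x ∷ xs) (suc i) same differs nu>0 with x ≟ part mu 1
... | no x≢mu = ⊥-elim (x≢mu (same 1 λ ()))
... | yes _   = cong (map₁ suc)
      (addedBox-first-difference (drop 1 mu) xs i same′ (differs ∘ (λ e → trans e (part-drop mu i))) nu>0)
  where
  same′ : ∀ k → k ≢ suc i → part xs k ≡ part (drop 1 mu) k
  same′ zero    _   = trans (part-zero xs) (sym (part-zero (drop 1 mu)))
  same′ (suc k) k≢i = trans (same (suc (suc k)) (k≢i ∘ cong pred)) (sym (part-drop mu k))

addedBox-AddsBox : ∀ {mu nu b} → AddsBox mu nu b → addedBox mu nu ≡ b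
addedBox-AddsBox {mu} {nu} {suc i , j} A =
  trans (addedBox-first-difference mu nu i part-other
           (λ nu≡mu → <-irrefl (sym nu≡mu) (subst (part mu (suc i) <_) (sym (trans part-row col≡)) ≤-refl))
           (subst (0 <_) (sym (trans part-row col≡)) (s≤s z≤n)))
        (cong (suc i ,_) part-row)
  where open AddsBox A

⋖⇒AddsBox : ∀ {mu nu} → mu ⋖ nu → AddsBox mu nu (addedBox mu nu)
⋖⇒AddsBox {mu} {nu} (mu⊆nu , (i , j) , (i≥1 , mu<j , j≤nu) , only) =
  subst (AddsBox mu nu) (sym (addedBox-AddsBox A)) A
  where
  other : ∀ k → k ≢ i → part nu k ≡ part mu k
  other zero    _   = trans (part-zero nu) (sym (part-zero mu))
  other (suc k) k≢i with m≤n⇒m<n∨m≡n (mu⊆nu (suc k))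
  ... | inj₂ mu≡nu = sym mu≡nu
  ... | inj₁ mu<nu = ⊥-elim (k≢i (cong proj₁ (only (suc k , part nu (suc k)) (s≤s z≤n , mu<nu , ≤-refl))))
  A : AddsBox mu nu (i , j)
  A = record
    { row-positive = i≥1
    ; col≡         = sym (cong proj₂ (only (i , suc (part mu i)) (i≥1 , ≤-refl , ≤-trans mu<j j≤nu)))
    ; part-row     = cong proj₂ (only (i , part nu i) (i≥1 , <-≤-trans mu<j j≤nu , ≤-refl))
    ; part-other   = other
    }

addedBox-injective : ∀ {mu nu nu′} → IsPartition nu → IsPartition nu′ → mu ⋖ nu → mu ⋖ nu′ →
  addedBox mu nu ≡ addedBox mu nu′ → nu ≡ nu′
addedBox-injective {mu} {nu} {nu′} P P′ cv cv′ same-box =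
  partition-ext P P′ λ k → AddsBox-functional (⋖⇒AddsBox {mu} {nu} cv)
    (subst (AddsBox mu nu′) (sym same-box) (⋖⇒AddsBox {mu} {nu′} cv′)) (suc k)

-- adds a box at the end of row suc i (rows are 1-indexed, as in part)
growRow : List ℕ → ℕ → List ℕ
growRow []       zero    = 1 ∷ []
growRow (x ∷ xs) zero    = suc x ∷ xs
growRow []       (suc i) = 0 ∷ growRow [] i
growRow (x ∷ xs) (suc i) = x ∷ growRow xs i

part-growRow-same : ∀ mu i → part (growRow mu i) (suc i) ≡ suc (part mu (suc i))
part-growRow-same []       zero    = refl
part-growRow-same (_ ∷ _)  zero    = refl
part-growRow-same []       (suc i) = part-growRow-same [] i
part-growRow-same (_ ∷ mu) (suc i) = part-growRow-same mu i

part-growRow-other : ∀ mu i k → k ≢ suc i → part (growRow mu i) k ≡ part mu k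
part-growRow-other mu       i       zero          _   = trans (part-zero (growRow mu i)) (sym (part-zero mu))
part-growRow-other mu       zero    (suc zero)    k≢1 = ⊥-elim (k≢1 refl)
part-growRow-other []       zero    (suc (suc k)) _   = refl
part-growRow-other (_ ∷ _)  zero    (suc (suc k)) _   = refl
part-growRow-other []       (suc i) (suc zero)    _   = refl
part-growRow-other (_ ∷ _)  (suc i) (suc zero)    _   = refl
part-growRow-other []       (suc i) (suc (suc k)) k≢i = part-growRow-other [] i (suc k) (k≢i ∘ cong suc)
part-growRow-other (_ ∷ mu) (suc i) (suc (suc k)) k≢i = part-growRow-other mu i (suc k) (k≢i ∘ cong suc)

growRow-AddsBox : ∀ mu i → AddsBox mu (growRow mu i) (suc i , suc (part mu (suc i)))
growRow-AddsBox mu i = record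
  { row-positive = s≤s z≤n
  ; col≡         = refl
  ; part-row     = part-growRow-same mu i
  ; part-other   = part-growRow-other mu i
  }

CanGrow : List ℕ → ℕ → Set
CanGrow mu zero    = ⊤
CanGrow mu (suc i) = part mu (suc (suc i)) < part mu (suc i)

growRow-isPartition : ∀ mu i → IsPartition mu → CanGrow mu i → IsPartition (growRow mu i)
growRow-isPartition []       zero          _ _ = [-] , s≤s z≤n ∷ []
growRow-isPartition (x ∷ xs) zero          P _ =
  IsPartition-∷ (s≤s z≤n) (≤-trans (second≤head P) (n≤1+n x)) (IsPartition-tail P)
growRow-isPartition (x ∷ xs) (suc zero)    P@(_ , x>0 ∷ _) second<x =
  IsPartition-∷ x>0 (subst (_≤ x) (sym (part-growRow-same xs 0)) second<x)
    (growRow-isPartition xs zero (IsPartition-tail P) tt)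
growRow-isPartition (x ∷ xs) (suc (suc i)) P@(_ , x>0 ∷ _) grow =
  IsPartition-∷ x>0 (subst (_≤ x) (sym (part-growRow-other xs (suc i) 1 λ ())) (second≤head P))
    (growRow-isPartition xs (suc i) (IsPartition-tail P) grow)

-- Standard tableaux

record Ordered (_≺_ : Box → Box → Set) (T : List Box) : Set where
  constructor ordered
  field
    position< : ∀ (p q : Fin (length T)) → lookup T p ≺ lookup T q → p Fin.< q

_≺row_ : Box → Box → Set
(i , j) ≺row (i′ , j′) = i ≡ i′ × j < j′

_≺col_ : Box → Box → Set
(i , j) ≺col (i′ , j′) = j ≡ j′ × i < i′

module _ {_≺_ : Box → Box → Set} {b : Box} {T : List Box} where

  Ordered-∷ : ¬ b ≺ b → (∀ {c} → c ∈ T → ¬ c ≺ b) → Ordered _≺_ T → Ordered _≺_ (b ∷ T)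
  Ordered-∷ b⊀b T⊀b (ordered o) = ordered λ where
    Fin.zero    Fin.zero    b≺b → ⊥-elim (b⊀b b≺b)
    Fin.zero    (Fin.suc _) _   → s≤s z≤n
    (Fin.suc p) Fin.zero    c≺b → ⊥-elim (T⊀b (∈-lookup p) c≺b)
    (Fin.suc p) (Fin.suc q) c≺d → s≤s (o p q c≺d)

  Ordered-tail : Ordered _≺_ (b ∷ T) → Ordered _≺_ T
  Ordered-tail (ordered o) = ordered λ p q c≺d → ≤-pred (o (Fin.suc p) (Fin.suc q) c≺d)

  Ordered-head-minimal : Ordered _≺_ (b ∷ T) → ∀ {c} → c ∈ b ∷ T → ¬ c ≺ b
  Ordered-head-minimal (ordered o) c∈ c≺b =
    n≮0 (o (index c∈) Fin.zero (subst (_≺ b) (lookup-index c∈) c≺b))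

module _ {T : List Box} where

  rows-Ordered : (∀ (p q : Fin (length T)) (i j j′ : ℕ) →
      lookup T p ≡ (i , j) → lookup T q ≡ (i , j′) → j < j′ → p Fin.< q) →
    Ordered _≺row_ T
  rows-Ordered rows = ordered λ p q (i≡i′ , j<j′) → rows p q _ _ _ refl (cong (_, _) (sym i≡i′)) j<j′

  Ordered-rows : Ordered _≺row_ T →
    ∀ (p q : Fin (length T)) (i j j′ : ℕ) →
      lookup T p ≡ (i , j) → lookup T q ≡ (i , j′) → j < j′ → p Fin.< q
  Ordered-rows (ordered o) p q i j j′ Tp Tq j<j′ = o p q (subst₂ _≺row_ (sym Tp) (sym Tq) (refl , j<j′))

  cols-Ordered : (∀ (p q : Fin (length T)) (i i′ j : ℕ) →
      lookup T p ≡ (i , j) → lookup T q ≡ (i′ , j) → i < i′ → p Fin.< q) →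
    Ordered _≺col_ T
  cols-Ordered cols = ordered λ p q (j≡j′ , i<i′) → cols p q _ _ _ refl (cong (_ ,_) (sym j≡j′)) i<i′

  Ordered-cols : Ordered _≺col_ T →
    ∀ (p q : Fin (length T)) (i i′ j : ℕ) →
      lookup T p ≡ (i , j) → lookup T q ≡ (i′ , j) → i < i′ → p Fin.< q
  Ordered-cols (ordered o) p q i i′ j Tp Tq i<i′ = o p q (subst₂ _≺col_ (sym Tp) (sym Tq) (refl , i<i′))

module _ {la mu nu : List ℕ} {i j : ℕ} (A : AddsBox mu nu (i , j)) {T : List Box} where
  open AddsBox A

  ∷-isSYT : IsPartition nu → j ≤ part la i → IsSYT la nu T → IsSYT la mu ((i , j) ∷ T)
  ∷-isSYT P j≤la (T! , T⇔Y , rows , cols) =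
    All.tabulate (λ c∈T ij≡c → AddsBox-∉ A {la} (subst (InY la nu) (sym ij≡c) (to (T⇔Y _) c∈T))) ∷ T! ,
    ∈-∷⇔Y ,
    Ordered-rows (Ordered-∷ (λ (_ , j<j) → <-irrefl refl j<j) left-of-new (rows-Ordered rows)) ,
    Ordered-cols (Ordered-∷ (λ (_ , i<i) → <-irrefl refl i<i) above-new (cols-Ordered cols))
    where
    ∈-∷⇔Y : ∀ b → b ∈ (i , j) ∷ T ⇔ InY la mu b
    ∈-∷⇔Y b = mk⇔
      (λ { (here refl) → from (InY-AddsBox A {la} j≤la b) (inj₁ refl)
         ; (there b∈T) → from (InY-AddsBox A {la} j≤la b) (inj₂ (to (T⇔Y b) b∈T)) })
      (λ b∈Y → [ (λ { refl → here refl }) , there ∘ from (T⇔Y b) ]′ (to (InY-AddsBox A {la} j≤la b) b∈Y))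
    left-of-new : ∀ {c} → c ∈ T → ¬ c ≺row (i , j)
    left-of-new {k , l} c∈T (refl , l<j) with to (T⇔Y _) c∈T
    ... | _ , nu<l , _ = <-asym nu<l (subst (l <_) (sym part-row) l<j)
    above-new : ∀ {c} → c ∈ T → ¬ c ≺col (i , j)
    above-new {k , l} c∈T (refl , k<i) with to (T⇔Y _) c∈T
    ... | k≥1 , nu<j , _ =
      <-irrefl refl (<-≤-trans nu<j (subst (_≤ part nu k) part-row (part-antitone P k≥1 (<⇒≤ k<i))))

  tail-isSYT : IsSYT la mu ((i , j) ∷ T) → IsSYT la nu T
  tail-isSYT (new∉T ∷ T! , ∷⇔Y , rows , cols) =
    T! , T⇔Y , Ordered-rows (Ordered-tail (rows-Ordered rows)) , Ordered-cols (Ordered-tail (cols-Ordered cols))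
    where
    j≤la : j ≤ part la i
    j≤la = proj₂ (proj₂ (to (∷⇔Y _) (here refl)))
    T⇔Y : ∀ b → b ∈ T ⇔ InY la nu b
    T⇔Y b = mk⇔
      (λ b∈T → [ (λ b≡new → ⊥-elim (All.lookup new∉T b∈T (sym b≡new))) , id ]′
                 (to (InY-AddsBox A {la} j≤la b) (to (∷⇔Y b) (there b∈T))))
      (λ b∈Y → from-∷ b∈Y (from (∷⇔Y b) (from (InY-AddsBox A {la} j≤la b) (inj₂ b∈Y))))
      where
      from-∷ : InY la nu b → b ∈ (i , j) ∷ T → b ∈ T
      from-∷ b∈Y (here refl)  = ⊥-elim (AddsBox-∉ A {la} b∈Y)
      from-∷ _   (there b∈T) = b∈T

-- Otherwise the box just right of μ in the same row would be a box of λ/μ labelled later.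
head-col≡ : ∀ {la mu i j T} → IsSYT la mu ((suc i , j) ∷ T) → j ≡ suc (part mu (suc i))
head-col≡ (_ , ∷⇔Y , rows , _) with to (∷⇔Y _) (here refl)
... | _ , mu<j , j≤la with m≤n⇒m<n∨m≡n mu<j
...   | inj₂ first = sym first
...   | inj₁ gap   = ⊥-elim (Ordered-head-minimal (rows-Ordered rows)
                       (from (∷⇔Y _) (s≤s z≤n , ≤-refl , ≤-trans (<⇒≤ gap) j≤la)) (refl , gap))

-- Otherwise the box above the head would be a box of λ/μ labelled later.
head-canGrow : ∀ {la mu i j T} → IsPartition la → IsSYT la mu ((suc i , j) ∷ T) → CanGrow mu i
head-canGrow {i = zero}                   _   _ = tt
head-canGrow {la} {mu} {suc i} {j} Pla S@(_ , ∷⇔Y , _ , cols) with j ≤? part mu (suc i)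
... | yes j≤mu = subst (_≤ part mu (suc i)) (head-col≡ {la} {mu} S) j≤mu
... | no j≰mu  = ⊥-elim (Ordered-head-minimal (cols-Ordered cols)
                   (from (∷⇔Y _) (s≤s z≤n , ≰⇒> j≰mu , ≤-trans j≤la la-below))
                   (refl , ≤-refl))
  where
  j≤la : j ≤ part la (suc (suc i))
  j≤la = proj₂ (proj₂ (to (∷⇔Y _) (here refl)))
  la-below : part la (suc (suc i)) ≤ part la (suc i)
  la-below = part-antitone Pla (s≤s z≤n) (n≤1+n _)

CoversIn : List ℕ → List ℕ → List ℕ → Set
CoversIn la mu nu = IsPartition nu × (mu ⋖ nu) × (nu ⊆ₚ la)

prepend-isSYT : ∀ {la mu nu T} → CoversIn la mu nu → IsSYT la nu T → IsSYT la mu (addedBox mu nu ∷ T)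
prepend-isSYT {la} {mu} {nu} (Pnu , mu⋖nu , nu⊆la) =
  ∷-isSYT {la} A Pnu (subst (_≤ part la (proj₁ (addedBox mu nu))) (AddsBox.part-row A) (nu⊆la _))
  where
  A : AddsBox mu nu (addedBox mu nu)
  A = ⋖⇒AddsBox mu⋖nu

removeFirst : ∀ {la mu b T} → IsPartition la → IsPartition mu → mu ⊆ₚ la → IsSYT la mu (b ∷ T) →
  ∃ λ nu → CoversIn la mu nu × addedBox mu nu ≡ b × IsSYT la nu T
removeFirst {la} {mu} {r , j} Pla Pmu mu⊆la S with to (proj₁ (proj₂ S) (r , j)) (here refl)
... | s≤s {n = i} z≤n , _ , j≤la =
  growRow mu i ,
  (growRow-isPartition mu i Pmu (head-canGrow {la} {mu} Pla S) , AddsBox⇒⋖ A , AddsBox-within A {la} mu⊆la j≤la) ,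
  addedBox-AddsBox A ,
  tail-isSYT {la} A S
  where
  A : AddsBox mu (growRow mu i) (suc i , j)
  A = subst (λ j → AddsBox mu (growRow mu i) (suc i , j)) (sym (head-col≡ {la} {mu} S)) (growRow-AddsBox mu i)

IsSYT-[] : ∀ {la mu} → IsPartition la → IsPartition mu → mu ⊆ₚ la → IsSYT la mu [] → la ≡ mu
IsSYT-[] {la} {mu} Pla Pmu mu⊆la (_ , []⇔Y , _) = partition-ext Pla Pmu λ k → no-box (suc k) (s≤s z≤n)
  where
  no-box : ∀ k → 1 ≤ k → part la k ≡ part mu k
  no-box k k≥1 with m≤n⇒m<n∨m≡n (mu⊆la k)
  ... | inj₂ mu≡la = sym mu≡la
  ... | inj₁ mu<la with from ([]⇔Y _) (k≥1 , mu<la , ≤-refl)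
  ...   | ()

IsSYT-self⇔[] : ∀ {la} T → IsSYT la la T ⇔ T ≡ []
IsSYT-self⇔[] {la} T =
  mk⇔ (only-[] T) λ { refl → [] , (λ b → mk⇔ (λ ()) (⊥-elim ∘ empty-Y)) , (λ ()) , (λ ()) }
  where
  empty-Y : ∀ {b} → ¬ InY la la b
  empty-Y (_ , la<j , j≤la) = <-irrefl refl (<-≤-trans la<j j≤la)
  only-[] : ∀ T → IsSYT la la T → T ≡ []
  only-[] []      _             = refl
  only-[] (b ∷ _) (_ , T⇔Y , _) = ⊥-elim (empty-Y (to (T⇔Y b) (here refl)))

module Decomposition
  (syt : List ℕ → List ℕ → List (List Box))
  (syt-enumerates : ∀ la mu → IsPartition la → IsPartition mu → mu ⊆ₚ la → EnumeratesSYT la mu (syt la mu))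
  {la mu : List ℕ} (Pla : IsPartition la) (Pmu : IsPartition mu) (mu⊆la : mu ⊆ₚ la)
  {nus : List (List ℕ)} (nus-enumerate : ∀ nu → nu ∈ nus ⇔ CoversIn la mu nu)
  where

  extensions : List ℕ → List (List Box)
  extensions nu = map (addedBox mu nu ∷_) (syt la nu)

  enumerates-cover : ∀ {nu} → nu ∈ nus → EnumeratesSYT la nu (syt la nu)
  enumerates-cover {nu} nu∈ = let Pnu , _ , nu⊆la = to (nus-enumerate nu) nu∈ in syt-enumerates la nu Pla Pnu nu⊆la

  extension-isSYT : ∀ {nu T} → nu ∈ nus → T ∈ syt la nu → IsSYT la mu (addedBox mu nu ∷ T)
  extension-isSYT {nu} {T} nu∈ T∈ =
    prepend-isSYT {la} (to (nus-enumerate nu) nu∈) (to (proj₂ (enumerates-cover nu∈) T) T∈)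

  extensions-unique : Unique nus → Unique (concatMap extensions nus)
  extensions-unique nus! =
    concatMap-unique extensions nus! (λ nu∈ → Unique.map⁺ List.∷-injectiveʳ (proj₁ (enumerates-cover nu∈))) disjoint
    where
    disjoint : ∀ {nu nu′ T} → nu ∈ nus → nu′ ∈ nus →
      T ∈ extensions nu → T ∈ extensions nu′ → nu ≡ nu′
    disjoint {nu} {nu′} nu∈ nu′∈ T∈ T∈′
      with _ , _ , refl ← ∈-map⁻ (addedBox mu nu ∷_) T∈
         | _ , _ , T≡ ← ∈-map⁻ (addedBox mu nu′ ∷_) T∈′ =
      let Pnu , mu⋖nu , _ = to (nus-enumerate nu) nu∈
          Pnu′ , mu⋖nu′ , _ = to (nus-enumerate nu′) nu′∈
      in addedBox-injective Pnu Pnu′ mu⋖nu mu⋖nu′ (List.∷-injectiveˡ T≡)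

  syt⇔extensions : la ≢ mu → ∀ T → T ∈ syt la mu ⇔ T ∈ concatMap extensions nus
  syt⇔extensions la≢mu T = mk⇔ (syt→extension T ∘ to syt⇔) (from syt⇔ ∘ extension→syt)
    where
    syt⇔ : T ∈ syt la mu ⇔ IsSYT la mu T
    syt⇔ = proj₂ (syt-enumerates la mu Pla Pmu mu⊆la) T
    syt→extension : ∀ T → IsSYT la mu T → T ∈ concatMap extensions nus
    syt→extension []      S = ⊥-elim (la≢mu (IsSYT-[] Pla Pmu mu⊆la S))
    syt→extension (b ∷ T) S with nu , cov , refl , S′ ← removeFirst Pla Pmu mu⊆la S =
      let nu∈ = from (nus-enumerate nu) cov
          T∈ = from (proj₂ (enumerates-cover nu∈) T) S′
      in ∈-concatMap⁺ extensions (lose nu∈ (∈-map⁺ (addedBox mu nu ∷_) T∈))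
    extension→syt : T ∈ concatMap extensions nus → IsSYT la mu T
    extension→syt T∈ = let _ , nu∈ , T∈ext = find (∈-concatMap⁻ extensions T∈) in from-extension nu∈ T∈ext
      where
      from-extension : ∀ {nu T} → nu ∈ nus → T ∈ extensions nu → IsSYT la mu T
      from-extension {nu} nu∈ T∈ext with _ , T′∈ , refl ← ∈-map⁻ (addedBox mu nu ∷_) T∈ext =
        extension-isSYT nu∈ T′∈

module _ {c ℓ : Level} (R : CommutativeRing c ℓ) where
  open CommutativeRing R hiding (refl)
  open Sums R

  open import Relation.Binary.Reasoning.Setoid setoid

  module Weights (inv : Carrier → Carrier) (inverse : ∀ x → ¬ (x ≈ 0#) → x * inv x ≈ 1#) (z : ℤ → Carrier)
    (z-nonvanishing : ∀ (ks : List ℤ) → ks ≢ [] → ¬ (foldr (λ k s → z k + s) 0# ks ≈ 0#))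
    where

    zsum-nonzero : ∀ {b bs} → ¬ (zsum R z (b ∷ bs) ≈ 0#)
    zsum-nonzero {b} {bs} =
      subst (λ s → ¬ (s ≈ 0#)) (List.foldr-map (λ k s → z k + s) content 0# (b ∷ bs))
        (z-nonvanishing (map content (b ∷ bs)) λ ())

    zT-∷ : ∀ {la mu b T Ys} → Unique Ys → (∀ c → c ∈ Ys ⇔ InY la mu c) → IsSYT la mu (b ∷ T) →
      zT R inv z (b ∷ T) ≈ inv (zsum R z Ys) * zT R inv z T
    zT-∷ {b = b} {T} Ys! Ys⇔Y (T! , T⇔Y , _) =
      *-congʳ (inv-cong inv inverse (zsum-nonzero {b} {T})
        (sumL-⇔ _ T! Ys! λ c → ⇔.trans (T⇔Y c) (⇔.sym (Ys⇔Y c))))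

    sumL-zT-self : ∀ {la Ts} → EnumeratesSYT la la Ts → sumL R Ts (zT R inv z) ≈ 1#
    sumL-zT-self {la} {Ts} (Ts! , Ts⇔SYT) = begin
      sumL R Ts (zT R inv z)  ≈⟨ sumL-⇔ (zT R inv z) Ts! ([] ∷ []) Ts⇔[[]] ⟩
      1# + 0#                 ≈⟨ +-identityʳ 1# ⟩
      1#                      ∎
      where
      Ts⇔[[]] : ∀ T → T ∈ Ts ⇔ T ∈ [] ∷ []
      Ts⇔[[]] T = ⇔.trans (Ts⇔SYT T)
        (⇔.trans (IsSYT-self⇔[] {la} T) (mk⇔ (λ { refl → here refl }) λ { (here refl) → refl }))

    sumL-zT-prepend : ∀ {la mu b Ys Ts} → Unique Ys → (∀ c → c ∈ Ys ⇔ InY la mu c) →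
      (∀ {T} → T ∈ Ts → IsSYT la mu (b ∷ T)) →
      sumL R (map (b ∷_) Ts) (zT R inv z) ≈ inv (zsum R z Ys) * sumL R Ts (zT R inv z)
    sumL-zT-prepend {la} {mu} {b} {Ys} {Ts} Ys! Ys⇔Y Ts-extend = begin
      sumL R (map (b ∷_) Ts) (zT R inv z)           ≡⟨ List.foldr-map _ (b ∷_) 0# Ts ⟩
      sumL R Ts (λ T → zT R inv z (b ∷ T))          ≈⟨ sumL-cong Ts (zT-∷ {la} {mu} Ys! Ys⇔Y ∘ Ts-extend) ⟩
      sumL R Ts (λ T → inv (zsum R z Ys) * zT R inv z T) ≈⟨ *-distribˡ-sumL (inv (zsum R z Ys)) (zT R inv z) Ts ⟨
      inv (zsum R z Ys) * sumL R Ts (zT R inv z)   ∎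

lemma4p5 : ∀ {c ℓ : Level} (R : CommutativeRing c ℓ) →
    let open CommutativeRing R in
    -- R is a field with inverse inv
    (inv : Carrier → Carrier) → ¬ (1# ≈ 0#) → (∀ x → ¬ (x ≈ 0#) → x * inv x ≈ 1#) →
    -- the z_k behave like indeterminates: no nonempty sum of them vanishes
    (z : ℤ → Carrier) → (∀ (ks : List ℤ) → ks ≢ [] → ¬ (foldr (λ k s → z k + s) 0# ks ≈ 0#)) →
    -- syt la mu enumerates SYT(la/mu)
    (syt : List ℕ → List ℕ → List (List Box)) →
    (∀ la mu → IsPartition la → IsPartition mu → mu ⊆ₚ la → EnumeratesSYT la mu (syt la mu)) →
    ∀ (la mu : List ℕ) → IsPartition la → IsPartition mu → mu ⊆ₚ la →
    (la ≡ mu → sumL R (syt la mu) (zT R inv z) ≈ 1#)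
    × (la ≢ mu →
       ∀ (Ys : List Box) → Unique Ys → (∀ b → (b ∈ Ys) ⇔ InY la mu b) →
       ∀ (nus : List (List ℕ)) → Unique nus →
       (∀ nu → (nu ∈ nus) ⇔ (IsPartition nu × (mu ⋖ nu) × (nu ⊆ₚ la))) →
       sumL R (syt la mu) (zT R inv z)
         ≈ inv (zsum R z Ys) * sumL R nus (λ nu → sumL R (syt la nu) (zT R inv z)))
lemma4p5 R inv _ inverse z z-nonvanishing syt syt-enumerates la mu Pla Pmu mu⊆la =
  (λ { refl → sumL-zT-self {la} (syt-enumerates la la Pla Pla (λ _ → ≤-refl)) }) ,
  λ la≢mu Ys Ys! Ys⇔Y nus nus! nus⇔ →
    let open Decomposition syt syt-enumerates Pla Pmu mu⊆la nus⇔
        S : Carrier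
        S = inv (zsum R z Ys)
    in begin
    sumL R (syt la mu) W                            ≈⟨ sumL-⇔ W (proj₁ (syt-enumerates la mu Pla Pmu mu⊆la))
                                                        (extensions-unique nus!) (syt⇔extensions la≢mu) ⟩
    sumL R (concatMap extensions nus) W             ≈⟨ sumL-concatMap W extensions nus ⟩
    sumL R nus (λ nu → sumL R (extensions nu) W)     ≈⟨ sumL-cong nus (λ nu∈ →
                                                         sumL-zT-prepend {la} {mu} Ys! Ys⇔Y (extension-isSYT nu∈)) ⟩
    sumL R nus (λ nu → S * sumL R (syt la nu) W)     ≈⟨ *-distribˡ-sumL S _ nus ⟨
    S * sumL R nus (λ nu → sumL R (syt la nu) W)     ∎
  where
  open CommutativeRing R hiding (refl)
  open Sums R
  open Weights R inv inverse z z-nonvanishing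
  open import Relation.Binary.Reasoning.Setoid setoid
  W : List Box → Carrier
  W = zT R inv z
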